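{- Let $d \ge 3$ be an integer. Then there exists $n_0 = n_0(d)$ such that for every integer $n \ge n_0$ there is a tiling of some $d$-dimensional cube by exactly $n$ smaller cubes. Each cube in the tiling has side length $1$, $\tfrac12$, or $\tfrac{1}{2^d-1}$.
   Context: A tiling of a cube $C$ by cubes is a finite collection of $d$-dimensional cubes with pairwise disjoint interiors whose union is $C$. -}

module Defs where

open import Data.Nat as ℕ using (ℕ; suc; _^_; _∸_)
open import Data.Integer using (+_)
open import Data.Rational using (ℚ; 0ℚ; 1ℚ; ½; _/_; _+_; _≤_; _<_)
open import Data.Fin using (Fin)
open import Data.Product using (Σ; ∃; _×_)
open import Data.Sum using (_⊎_)
open import Relation.Binary.PropositionalEquality using (_≡_; _≢_)
open import Relation.Nullary using (¬_)

Point : ℕ → Set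
Point d = Fin d → ℚ

-- An axis-parallel d-dimensional cube [a₁,a₁+s] × … × [a_d,a_d+s].
record Cube (d : ℕ) : Set where
  constructor cube
  field
    corner : Point d
    side   : ℚ
open Cube public

_∈ᶜ_ : ∀ {d} → Point d → Cube d → Set
x ∈ᶜ Q = ∀ i → corner Q i ≤ x i × x i ≤ corner Q i + side Q

_∈ⁱ_ : ∀ {d} → Point d → Cube d → Set
x ∈ⁱ Q = ∀ i → corner Q i < x i × x i < corner Q i + side Q

IsTiling : ∀ {d n} → Cube d → (Fin n → Cube d) → Set
IsTiling {d} {n} C Q =
  (0ℚ < side C) ×
  (∀ j → 0ℚ < side (Q j)) ×
  (∀ j k → j ≢ k → ¬ (Σ (Point d) λ x → x ∈ⁱ Q j × x ∈ⁱ Q k)) ×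
  (∀ j (x : Point d) → x ∈ᶜ Q j → x ∈ᶜ C) ×
  (∀ (x : Point d) → x ∈ᶜ C → ∃ λ j → x ∈ᶜ Q j)

-- 1 / (2^d - 1); written with denominator suc (2^d ∸ 2), which equals
-- 2^d - 1 for every d ≥ 1 (only used for d ≥ 3).
invMersenne : ℕ → ℚ
invMersenne d = + 1 / suc (2 ^ d ∸ 2)

AllowedSide : ℕ → ℚ → Set
AllowedSide d s = s ≡ 1ℚ ⊎ s ≡ ½ ⊎ s ≡ invMersenne d

module Submission where

-- A cube of side N ≥ 2 is a grid of N^d unit cubes, and each unit cube can be kept, cut into 2^d
-- cubes of side 1/2, or cut into m^d cubes of side 1/m, where m = 2^d − 1. These choices add 0, m
-- or M = m^d − 1 tiles, so the counts N^d + a m + b M with a + b ≤ N^d are realised. As M ≡ −1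
-- (mod m), every residue class is reached with b ≤ m; hence every n in a window
-- N^d + K ≤ n ≤ 2^d N^d − T (K, T depending only on d) is such a count, and for large N the
-- windows of consecutive N overlap.

open import Defs

module Counting where

  open import Data.Nat using (ℕ; zero; suc; _+_; _*_; _^_; _∸_; _≤_; z≤n; s≤s; NonZero; >-nonZero)
  open import Data.Nat.Properties
  open import Data.Nat.DivMod using (_/_; _%_; m≡m%n+[m/n]*n; m%n<n; m*n/n≡m; /-monoˡ-≤)
  open import Data.Nat.Solver using (module +-*-Solver)
  open import Data.Product using (∃; ∃₂; _×_; _,_)
  open import Data.Sum using (_⊎_; inj₁; inj₂)
  open import Relation.Binary.PropositionalEquality
  open +-*-Solver

  data SumOf (A : ℕ → Set) : ℕ → ℕ → Set where
    []  : SumOf A 0 0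
    _∷_ : ∀ {x k n} → A x → SumOf A k n → SumOf A (suc k) (x + n)

  module _ {A : ℕ → Set} where

    SumOf-splitAt : ∀ k {l n} → SumOf A (k + l) n →
                    ∃₂ λ n₁ n₂ → SumOf A k n₁ × SumOf A l n₂ × n ≡ n₁ + n₂
    SumOf-splitAt zero    s = 0 , _ , [] , s , refl
    SumOf-splitAt (suc k) (_∷_ {x} Ax s) with SumOf-splitAt k s
    ... | n₁ , n₂ , s₁ , s₂ , refl = x + n₁ , n₂ , Ax ∷ s₁ , s₂ , sym (+-assoc x n₁ n₂)

    SumOf-group : ∀ k {l n} → SumOf A (k * l) n → SumOf (SumOf A l) k n
    SumOf-group zero    [] = []
    SumOf-group (suc k) {l} s with SumOf-splitAt l s
    ... | _ , _ , s₁ , s₂ , refl = s₁ ∷ SumOf-group k s₂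

  SumOf-ones : ∀ k → SumOf (_≡ 1) k k
  SumOf-ones zero    = []
  SumOf-ones (suc k) = refl ∷ SumOf-ones k

  Coin : ℕ → ℕ → ℕ → Set
  Coin p q n = n ≡ 1 ⊎ n ≡ p ⊎ n ≡ q

  SumOf-coins : ∀ {m M} k a b → a + b ≤ k → SumOf (Coin (suc m) (suc M)) k (k + (a * m + b * M))
  SumOf-coins zero    zero    zero    _ = []
  SumOf-coins {m} {M} (suc k) (suc a) b (s≤s a+b≤k) =
    subst (SumOf (Coin (suc m) (suc M)) (suc k))
      (solve 5 (λ k a b m M → (con 1 :+ m) :+ (k :+ (a :* m :+ b :* M)) := con 1 :+ k :+ (m :+ a :* m :+ b :* M))
               refl k a b m M)
      (inj₂ (inj₁ refl) ∷ SumOf-coins k a b a+b≤k)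
  SumOf-coins {m} {M} (suc k) zero (suc b) (s≤s b≤k) =
    subst (SumOf (Coin (suc m) (suc M)) (suc k))
      (solve 3 (λ k b M → (con 1 :+ M) :+ (k :+ b :* M) := con 1 :+ k :+ (M :+ b :* M)) refl k b M)
      (inj₂ (inj₂ refl) ∷ SumOf-coins k 0 b b≤k)
  SumOf-coins (suc k) zero    zero    _ = inj₁ refl ∷ SumOf-coins k 0 0 z≤n

  -- b := m − r mod m makes r + b ≡ 0 (mod m); as M + 1 ≡ 0 (mod m), a := (r + b)/m − bP then works.
  two-coin-representation : ∀ {m M P r} .{{_ : NonZero m}} → suc M ≡ m * P → m * P * m ≤ r →
             ∃₂ λ a b → r ≡ a * m + b * M × (a + b) * m ≤ r + m * suc m
  two-coin-representation {m} {M} {P} {r} 1+M≡mP mPm≤r = a , b , r≡am+bM , a+b≤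
    where
    q = r / m
    ρ = r % m
    b = m ∸ ρ
    a = suc q ∸ b * P

    r≡ρ+qm : r ≡ ρ + q * m
    r≡ρ+qm = m≡m%n+[m/n]*n r m

    b+ρ≡m : b + ρ ≡ m
    b+ρ≡m = m∸n+n≡m (<⇒≤ (m%n<n r m))

    bP≤1+q : b * P ≤ suc q
    bP≤1+q = begin
      b * P         ≤⟨ *-monoˡ-≤ P (m∸n≤m m ρ) ⟩
      m * P         ≡⟨ m*n/n≡m (m * P) m ⟨
      m * P * m / m ≤⟨ /-monoˡ-≤ m mPm≤r ⟩
      q             ≤⟨ n≤1+n q ⟩
      suc q         ∎
      where open ≤-Reasoning

    a+bP≡1+q : a + b * P ≡ suc q
    a+bP≡1+q = m∸n+n≡m bP≤1+q

    r≡am+bM : r ≡ a * m + b * M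
    r≡am+bM = sym (+-cancelʳ-≡ b _ _ (begin
      a * m + b * M + b   ≡⟨ solve 4 (λ a m b M → a :* m :+ b :* M :+ b := a :* m :+ b :* (con 1 :+ M)) refl a m b M ⟩
      a * m + b * suc M   ≡⟨ cong (λ z → a * m + b * z) 1+M≡mP ⟩
      a * m + b * (m * P) ≡⟨ solve 4 (λ a m b P → a :* m :+ b :* (m :* P) := (a :+ b :* P) :* m) refl a m b P ⟩
      (a + b * P) * m     ≡⟨ cong (_* m) a+bP≡1+q ⟩
      suc q * m           ≡⟨ +-comm m (q * m) ⟩
      q * m + m           ≡⟨ cong (q * m +_) b+ρ≡m ⟨
      q * m + (b + ρ)     ≡⟨ solve 3 (λ qm b ρ → qm :+ (b :+ ρ) := ρ :+ qm :+ b) refl (q * m) b ρ ⟩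
      ρ + q * m + b       ≡⟨ cong (_+ b) r≡ρ+qm ⟨
      r + b               ∎))
      where open ≡-Reasoning

    a+b≤ : (a + b) * m ≤ r + m * suc m
    a+b≤ = begin
      (a + b) * m         ≤⟨ *-monoˡ-≤ m (+-mono-≤ (subst (a ≤_) a+bP≡1+q (m≤m+n a (b * P))) (m∸n≤m m ρ)) ⟩
      (suc q + m) * m     ≡⟨ solve 2 (λ q m → (con 1 :+ q :+ m) :* m := q :* m :+ m :* (con 1 :+ m)) refl q m ⟩
      q * m + m * suc m   ≤⟨ +-monoˡ-≤ (m * suc m) (subst (q * m ≤_) (sym r≡ρ+qm) (m≤n+m (q * m) ρ)) ⟩
      r + m * suc m       ∎
      where open ≤-Reasoning

  intervals-cover : (lo hi : ℕ → ℕ) {N₀ : ℕ} → lo N₀ ≤ hi N₀ →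
    (∀ {N} → N₀ ≤ N → lo (suc N) ≤ suc (hi N) × suc (hi N) ≤ hi (suc N)) →
    ∀ {n} → lo N₀ ≤ n → ∃ λ N → N₀ ≤ N × lo N ≤ n × n ≤ hi N
  intervals-cover lo hi {N₀} lo≤hi step {n} lo≤n =
    subst Covered (m+[n∸m]≡n lo≤n) (cover (n ∸ lo N₀))
    where
    Covered : ℕ → Set
    Covered n = ∃ λ N → N₀ ≤ N × lo N ≤ n × n ≤ hi N

    cover : ∀ k → Covered (lo N₀ + k)
    cover zero = N₀ , ≤-refl , m≤m+n (lo N₀) 0 , subst (_≤ hi N₀) (sym (+-identityʳ (lo N₀))) lo≤hi
    cover (suc k) with cover k
    ... | N , N₀≤N , lo≤x , x≤hi rewrite +-suc (lo N₀) k with m≤n⇒m<n∨m≡n x≤hi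
    ...   | inj₁ x<hi = N , N₀≤N , m≤n⇒m≤1+n lo≤x , x<hi
    ...   | inj₂ x≡hi rewrite x≡hi = suc N , m≤n⇒m≤1+n N₀≤N , step N₀≤N

  ^-distribʳ-* : ∀ m n o → (m * n) ^ o ≡ m ^ o * n ^ o
  ^-distribʳ-* m n zero    = refl
  ^-distribʳ-* m n (suc o) = begin
    m * n * (m * n) ^ o     ≡⟨ cong (m * n *_) (^-distribʳ-* m n o) ⟩
    m * n * (m ^ o * n ^ o) ≡⟨ solve 4 (λ m n x y → m :* n :* (x :* y) := m :* x :* (n :* y)) refl m n (m ^ o) (n ^ o) ⟩
    m * m ^ o * (n * n ^ o) ∎
    where open ≡-Reasoning

  [1+N]^d+c≤2^d*N^d : ∀ d′ c N → 2 + 2 ^ suc d′ * c ≤ N → suc N ^ suc d′ + c ≤ 2 ^ suc d′ * N ^ suc d′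
  [1+N]^d+c≤2^d*N^d d′ c N N-large = *-cancelˡ-≤ F {{m^n≢0 2 d}} (begin
    F * (suc N ^ d + c)       ≡⟨ *-distribˡ-+ F (suc N ^ d) c ⟩
    F * suc N ^ d + F * c     ≤⟨ +-mono-≤ doubled Fc≤N^d ⟩
    3 ^ d * N ^ d + N ^ d     ≡⟨ +-comm (3 ^ d * N ^ d) (N ^ d) ⟩
    suc (3 ^ d) * N ^ d       ≤⟨ *-monoˡ-≤ (N ^ d) (^-monoˡ-< d {3} {4} (s≤s ≤-refl)) ⟩
    (2 * 2) ^ d * N ^ d       ≡⟨ cong (_* N ^ d) (^-distribʳ-* 2 2 d) ⟩
    F * F * N ^ d             ≡⟨ *-assoc F F (N ^ d) ⟩
    F * (F * N ^ d)           ∎)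
    where
    open ≤-Reasoning
    d = suc d′
    F = 2 ^ d
    2≤N : 2 ≤ N
    2≤N = ≤-trans (m≤m+n 2 (F * c)) N-large
    doubled : F * suc N ^ d ≤ 3 ^ d * N ^ d
    doubled = begin
      F * suc N ^ d   ≡⟨ ^-distribʳ-* 2 (suc N) d ⟨
      (2 * suc N) ^ d ≤⟨ ^-monoˡ-≤ d (begin
                           2 * suc N ≡⟨ solve 1 (λ n → con 2 :* (con 1 :+ n) := con 2 :+ con 2 :* n) refl N ⟩
                           2 + 2 * N ≤⟨ +-monoˡ-≤ (2 * N) 2≤N ⟩
                           N + 2 * N ≡⟨ solve 1 (λ n → n :+ con 2 :* n := con 3 :* n) refl N ⟩
                           3 * N     ∎) ⟩
      (3 * N) ^ d     ≡⟨ ^-distribʳ-* 3 N d ⟩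
      3 ^ d * N ^ d   ∎
    Fc≤N^d : F * c ≤ N ^ d
    Fc≤N^d = begin
      F * c      ≤⟨ m≤n+m (F * c) 2 ⟩
      2 + F * c  ≤⟨ N-large ⟩
      N          ≤⟨ m≤m*n N (N ^ d′) {{m^n≢0 N d′ {{>-nonZero (≤-trans (s≤s z≤n) 2≤N)}}}} ⟩
      N ^ d      ∎

  -- 2^d − 1 for d ≥ 1, written as in invMersenne.
  mersenne : ℕ → ℕ
  mersenne d = suc (2 ^ d ∸ 2)

  -- K and T are the margins two-coin-representation needs; N₀ makes consecutive windows overlap.
  module Decomposition (d′ : ℕ) where
    private
      d = suc d′
      m = mersenne d
      M = m ^ d ∸ 1
      K = m ^ d * m
      T = m * suc m
      N₀ = 2 + 2 ^ d * (K + T)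

      1+m≡2^d : suc m ≡ 2 ^ d
      1+m≡2^d = m+[n∸m]≡n (^-monoʳ-≤ 2 {1} {d} (s≤s z≤n))

      1+M≡m^d : suc M ≡ m ^ d
      1+M≡m^d = m+[n∸m]≡n (m^n>0 m d)

      growth : ∀ {N} → N₀ ≤ N → suc N ^ d + K + T ≤ 2 ^ d * N ^ d
      growth {N} N₀≤N =
        subst (_≤ 2 ^ d * N ^ d) (sym (+-assoc (suc N ^ d) K T)) ([1+N]^d+c≤2^d*N^d d′ (K + T) N N₀≤N)

      representable : ∀ N r → K ≤ r → r + T ≤ m * N ^ d → ∃₂ λ a b → a + b ≤ N ^ d × r ≡ a * m + b * M
      representable N r K≤r r+T≤ with two-coin-representation {m} {M} {m ^ d′} 1+M≡m^d K≤r
      ... | a , b , r≡ , a+b≤ = a , b , *-cancelʳ-≤ (a + b) (N ^ d) m (begin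
        (a + b) * m ≤⟨ a+b≤ ⟩
        r + T       ≤⟨ r+T≤ ⟩
        m * N ^ d   ≡⟨ *-comm m (N ^ d) ⟩
        N ^ d * m   ∎) , r≡
        where open ≤-Reasoning

      lo hi : ℕ → ℕ
      lo N = N ^ d + K
      hi N = 2 ^ d * N ^ d ∸ T

      lo≤hi : lo N₀ ≤ hi N₀
      lo≤hi = m+n≤o⇒m≤o∸n (lo N₀) (≤-trans (+-monoˡ-≤ T (+-monoˡ-≤ K (^-monoˡ-≤ d (n≤1+n N₀)))) (growth ≤-refl))

      windows-overlap : ∀ {N} → N₀ ≤ N → lo (suc N) ≤ suc (hi N) × suc (hi N) ≤ hi (suc N)
      windows-overlap {N} N₀≤N =
        m≤n⇒m≤1+n (m+n≤o⇒m≤o∸n (lo (suc N)) (growth N₀≤N)) ,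
        ∸-monoˡ-< (*-monoʳ-< (2 ^ d) {{m^n≢0 2 d}} (^-monoˡ-< d (n<1+n N))) (≤-trans (m≤n+m T _) (growth N₀≤N))

      window⇒SumOf : ∀ {N n} → N₀ ≤ N → lo N ≤ n → n ≤ hi N → SumOf (Coin (2 ^ d) (m ^ d)) (N ^ d) n
      window⇒SumOf {N} {n} N₀≤N N^d+K≤n n≤hi =
        let a , b , a+b≤ , r≡ = representable N r K≤r r+T≤ in
        subst₂ (λ p q → SumOf (Coin p q) (N ^ d) n) 1+m≡2^d 1+M≡m^d
          (subst (SumOf _ (N ^ d)) (trans (cong (N ^ d +_) (sym r≡)) N^d+r≡n) (SumOf-coins (N ^ d) a b a+b≤))
        where
        r = n ∸ N ^ d
        N^d+r≡n : N ^ d + r ≡ n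
        N^d+r≡n = m+[n∸m]≡n (≤-trans (m≤m+n (N ^ d) K) N^d+K≤n)
        K≤r : K ≤ r
        K≤r = +-cancelˡ-≤ (N ^ d) K r (subst (N ^ d + K ≤_) (sym N^d+r≡n) N^d+K≤n)
        r+T≤ : r + T ≤ m * N ^ d
        r+T≤ = +-cancelˡ-≤ (N ^ d) (r + T) (m * N ^ d) (begin
          N ^ d + (r + T)   ≡⟨ +-assoc (N ^ d) r T ⟨
          N ^ d + r + T     ≡⟨ cong (_+ T) N^d+r≡n ⟩
          n + T             ≤⟨ m≤o∸n⇒m+n≤o n (≤-trans (m≤n+m T _) (growth N₀≤N)) n≤hi ⟩
          2 ^ d * N ^ d     ≡⟨ cong (_* N ^ d) 1+m≡2^d ⟨
          N ^ d + m * N ^ d ∎)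
          where open ≤-Reasoning

    decomposition : ∃ λ n₀ → ∀ {n} → n₀ ≤ n → ∃ λ N → 2 ≤ N × SumOf (Coin (2 ^ d) (m ^ d)) (N ^ d) n
    decomposition = lo N₀ , λ lo≤n →
      let N , N₀≤N , lo≤n′ , n≤hi = intervals-cover lo hi lo≤hi windows-overlap lo≤n
      in N , ≤-trans (m≤m+n 2 _) N₀≤N , window⇒SumOf N₀≤N lo≤n′ n≤hi

module Tilings where

  open Counting using (SumOf; []; _∷_; SumOf-group; SumOf-ones; Coin; mersenne)
  open import Data.Nat as ℕ using (ℕ; zero; suc; _^_; _∸_; s≤s)
  import Data.Nat.Properties as ℕ
  import Data.Nat.Coprimality as Coprime
  open import Data.Nat.Coprimality using (1-coprimeTo)
  import Data.Integer as ℤ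
  import Data.Integer.Properties as ℤ
  open import Data.Rational using (ℚ; mkℚ; 0ℚ; 1ℚ; ½; _/_; _≤_; _<_; _+_; _*_; 1/_; +-0-rawMonoid)
  open import Data.Rational.Properties hiding (_≟_)
  open import Algebra.Bundles using (Ring)
  open import Algebra.Definitions.RawMonoid +-0-rawMonoid using () renaming (_×_ to _·_)
  open import Algebra.Properties.Semiring.Mult (Ring.semiring +-*-ring) using (×-comm-*)
  open import Data.Fin using (Fin; zero; suc; toℕ; fromℕ<; _≟_)
  open import Data.Fin.Properties using (toℕ<n; toℕ-fromℕ<; toℕ-injective)
  open import Data.Vec.Functional using (updateAt)
  open import Data.Vec.Functional.Properties using (updateAt-updates; updateAt-minimal; updateAt-id-local)
  open import Data.List using (List; []; _∷_; _++_; length; lookup)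
  open import Data.List.Properties using (length-++)
  open import Data.List.Membership.Propositional.Properties using (∈-lookup)
  open import Data.List.Relation.Unary.All as All using (All; []; _∷_)
  import Data.List.Relation.Unary.All.Properties as All
  open import Data.List.Relation.Unary.Any as Any using (Any; here)
  import Data.List.Relation.Unary.Any.Properties as Any
  open import Data.List.Relation.Unary.AllPairs using (AllPairs; []; _∷_)
  import Data.List.Relation.Unary.AllPairs.Properties as AllPairs
  open import Data.Product using (Σ; ∃; _×_; _,_; proj₁; proj₂)
  open import Data.Sum using (inj₁; inj₂)
  open import Data.Bool using (if_then_else_)
  open import Function using (_∘_; const)
  open import Relation.Binary.Core using (Rel)
  open import Relation.Binary.Definitions using (Symmetric)
  open import Relation.Nullary using (¬_; yes; no; does; contradiction)
  open import Relation.Nullary.Decidable using (dec-true; dec-false)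
  open import Relation.Binary.PropositionalEquality

  p≤p+q : ∀ p {q} → 0ℚ ≤ q → p ≤ p + q
  p≤p+q p {q} 0≤q = subst (_≤ p + q) (+-identityʳ p) (+-monoʳ-≤ p 0≤q)

  ·-nonNeg : ∀ k {s} → 0ℚ ≤ s → 0ℚ ≤ k · s
  ·-nonNeg zero    0≤s = ≤-refl
  ·-nonNeg (suc k) {s} 0≤s = subst (_≤ s + k · s) (+-identityʳ 0ℚ) (+-mono-≤ 0≤s (·-nonNeg k 0≤s))

  p≤[1+k]·p : ∀ k {q} → 0ℚ ≤ q → q ≤ suc k · q
  p≤[1+k]·p k {q} 0≤q = p≤p+q q (·-nonNeg k 0≤q)

  ·1ℚ≡/1 : ∀ n → n · 1ℚ ≡ ℤ.+ n / 1
  ·1ℚ≡/1 zero    = refl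
  ·1ℚ≡/1 (suc n) = begin
    1ℚ + n · 1ℚ      ≡⟨ cong (1ℚ +_) (·1ℚ≡/1 n) ⟩
    1ℚ + ℤ.+ n / 1   ≡⟨ cong (1ℚ +_) (normalize-coprime (Coprime.sym (1-coprimeTo n))) ⟩
    1ℚ + mkℚ (ℤ.+ n) 0 (Coprime.sym (1-coprimeTo n))
                     ≡⟨ cong (_/ 1) (cong (ℤ._+_ (ℤ.+ 1)) (ℤ.*-identityʳ (ℤ.+ n))) ⟩
    ℤ.+ suc n / 1    ∎
    where open ≡-Reasoning

  ·-inverse : ∀ k → suc k · (ℤ.+ 1 / suc k) ≡ 1ℚ
  ·-inverse k = begin
    suc k · q          ≡⟨ cong (suc k ·_) (*-identityʳ q) ⟨
    suc k · (q * 1ℚ)   ≡⟨ ×-comm-* (suc k) q 1ℚ ⟨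
    q * (suc k · 1ℚ)   ≡⟨ cong₂ _*_ (normalize-coprime (1-coprimeTo (suc k)))
                                     (trans (·1ℚ≡/1 (suc k)) (normalize-coprime (Coprime.sym (1-coprimeTo (suc k))))) ⟩
    1/ p * p           ≡⟨ *-inverseˡ p ⟩
    1ℚ                 ∎
    where
    open ≡-Reasoning
    q = ℤ.+ 1 / suc k
    p = mkℚ (ℤ.+ suc k) 0 (Coprime.sym (1-coprimeTo (suc k)))

  updateAt-const-elim : ∀ {A : Set} {n} (P : Fin n → A → Set) (f : Fin n → A) (i : Fin n) {a : A} →
    P i a → (∀ j → j ≢ i → P j (f j)) → ∀ j → P j (updateAt f i (const a) j)
  updateAt-const-elim P f i Pa Pf j with j ≟ i
  ... | yes refl = subst (P j) (sym (updateAt-updates j f)) Pa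
  ... | no j≢i   = subst (P j) (sym (updateAt-minimal j i f j≢i)) (Pf j j≢i)

  module _ {A B : Set} {n : ℕ} where

    updateAt-const-pointwise : (R : Fin n → A → B → Set) {f : Fin n → A} {g : Fin n → B} (i : Fin n) {a : A} {b : B} →
      R i a b → (∀ j → j ≢ i → R j (f j) (g j)) → ∀ j → R j (updateAt f i (const a) j) (updateAt g i (const b) j)
    updateAt-const-pointwise R {f} {g} i {b = b} Rab Rfg =
      updateAt-const-elim (λ j x → R j x (updateAt g i (const b) j)) f i
        (subst (R i _) (sym (updateAt-updates i g)) Rab)
        (λ j j≢i → subst (R j (f j)) (sym (updateAt-minimal j i g j≢i)) (Rfg j j≢i))

  AllPairs-lookup : ∀ {a ℓ} {A : Set a} {R : Rel A ℓ} {xs : List A} → Symmetric R → AllPairs R xs →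
                    ∀ {i j} → i ≢ j → R (lookup xs i) (lookup xs j)
  AllPairs-lookup R-sym (_  ∷ _)   {zero}  {zero}  0≢0 = contradiction refl 0≢0
  AllPairs-lookup R-sym (Rx ∷ _)   {zero}  {suc j} _   = All.lookup Rx (∈-lookup j)
  AllPairs-lookup R-sym (Rx ∷ _)   {suc i} {zero}  _   = R-sym (All.lookup Rx (∈-lookup i))
  AllPairs-lookup R-sym (_  ∷ Rxs) {suc i} {suc j} i≢j = AllPairs-lookup R-sym Rxs (λ i≡j → i≢j (cong suc i≡j))

  record Box (d : ℕ) : Set where
    constructor box
    field
      lo hi : Point d
  open Box

  module _ {d : ℕ} where

    _∈ᵇ_ : Point d → Box d → Set
    x ∈ᵇ B = ∀ i → lo B i ≤ x i × x i ≤ hi B i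

    _⊑_ : Box d → Box d → Set
    B ⊑ B′ = ∀ i → lo B′ i ≤ lo B i × hi B i ≤ hi B′ i

    ⊑-trans : ∀ {B₁ B₂ B₃} → B₁ ⊑ B₂ → B₂ ⊑ B₃ → B₁ ⊑ B₃
    ⊑-trans B₁⊑B₂ B₂⊑B₃ i = ≤-trans (proj₁ (B₂⊑B₃ i)) (proj₁ (B₁⊑B₂ i)) , ≤-trans (proj₂ (B₁⊑B₂ i)) (proj₂ (B₂⊑B₃ i))

    ∈-⊑ : ∀ {x B B′} → x ∈ᵇ B → B ⊑ B′ → x ∈ᵇ B′
    ∈-⊑ x∈B B⊑B′ i = ≤-trans (proj₁ (B⊑B′ i)) (proj₁ (x∈B i)) , ≤-trans (proj₂ (x∈B i)) (proj₂ (B⊑B′ i))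

    ⟦_⟧ : Cube d → Box d
    ⟦ Q ⟧ = box (corner Q) (λ i → corner Q i + side Q)

    InteriorsDisjoint : Cube d → Cube d → Set
    InteriorsDisjoint Q R = ¬ (Σ (Point d) λ x → x ∈ⁱ Q × x ∈ⁱ R)

    separated⇒InteriorsDisjoint : ∀ {Q R} i → corner Q i + side Q ≤ corner R i → InteriorsDisjoint Q R
    separated⇒InteriorsDisjoint i Q≤R (x , x∈Q , x∈R) =
      <-irrefl refl (<-trans (<-≤-trans (proj₂ (x∈Q i)) Q≤R) (proj₁ (x∈R i)))

    record Tiling (S : ℚ → Set) (B : Box d) (n : ℕ) : Set where
      field
        tiles    : List (Cube d)
        count    : length tiles ≡ n
        sides    : All (S ∘ side) tiles
        inside   : All (λ Q → ⟦ Q ⟧ ⊑ B) tiles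
        disjoint : AllPairs InteriorsDisjoint tiles
        covering : ∀ x → x ∈ᵇ B → Any (x ∈ᶜ_) tiles
    open Tiling

    Admits : (ℚ → Set) → Box d → (ℕ → Set) → Set
    Admits S B A = ∀ {n} → A n → Tiling S B n

    Tiling-cong : ∀ {S B B′ n} → lo B ≗ lo B′ → hi B ≗ hi B′ → Tiling S B n → Tiling S B′ n
    Tiling-cong lo≗ hi≗ T = record
      { tiles    = tiles T
      ; count    = count T
      ; sides    = sides T
      ; disjoint = disjoint T
      ; inside   = All.map (λ Q⊑B i → subst (_≤ _) (lo≗ i) (proj₁ (Q⊑B i)) , subst (_ ≤_) (hi≗ i) (proj₂ (Q⊑B i))) (inside T)
      ; covering = λ x x∈B′ → covering T x (λ i → subst (_≤ x i) (sym (lo≗ i)) (proj₁ (x∈B′ i)) , subst (x i ≤_) (sym (hi≗ i)) (proj₂ (x∈B′ i)))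
      }

    Tiling-cube : ∀ {S l s} → S s → Tiling S ⟦ cube l s ⟧ 1
    Tiling-cube Ss = record
      { tiles    = cube _ _ ∷ []
      ; count    = refl
      ; sides    = Ss ∷ []
      ; inside   = (λ i → ≤-refl , ≤-refl) ∷ []
      ; disjoint = [] ∷ []
      ; covering = λ x x∈Q → here x∈Q
      }

    slab : Box d → Fin d → ℚ → ℚ → Box d
    slab B i a b = box (updateAt (lo B) i (const a)) (updateAt (hi B) i (const b))

    slab-⊑ : ∀ B i {a a′ b b′} → a ≤ a′ → b′ ≤ b → slab B i a′ b′ ⊑ slab B i a b
    slab-⊑ B i a≤a′ b′≤b j =
      updateAt-const-pointwise (λ _ → _≤_) i a≤a′ (λ _ _ → ≤-refl) j ,
      updateAt-const-pointwise (λ _ → _≤_) i b′≤b (λ _ _ → ≤-refl) j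

    ∈-slab : ∀ {B i a b a′ b′ x} → x ∈ᵇ slab B i a b → a′ ≤ x i → x i ≤ b′ → x ∈ᵇ slab B i a′ b′
    ∈-slab {B} {i} {x = x} x∈ a′≤x x≤b′ =
      updateAt-const-pointwise (λ j u v → u ≤ x j × x j ≤ v) i (a′≤x , x≤b′) λ j j≢i →
        subst (_≤ x j) (updateAt-minimal j i (lo B) j≢i) (proj₁ (x∈ j)) ,
        subst (x j ≤_) (updateAt-minimal j i (hi B) j≢i) (proj₂ (x∈ j))

    Tiling-glue : ∀ {S B i a b c n₁ n₂} → a ≤ c → c ≤ b →
      Tiling S (slab B i a c) n₁ → Tiling S (slab B i c b) n₂ → Tiling S (slab B i a b) (n₁ ℕ.+ n₂)
    Tiling-glue {B = B} {i} {a} {b} {c} a≤c c≤b T₁ T₂ = record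
      { tiles    = tiles T₁ ++ tiles T₂
      ; count    = trans (length-++ (tiles T₁)) (cong₂ ℕ._+_ (count T₁) (count T₂))
      ; sides    = All.++⁺ (sides T₁) (sides T₂)
      ; inside   = All.++⁺ (All.map (λ Q⊑ → ⊑-trans Q⊑ (slab-⊑ B i ≤-refl c≤b)) (inside T₁))
                           (All.map (λ Q⊑ → ⊑-trans Q⊑ (slab-⊑ B i a≤c ≤-refl)) (inside T₂))
      ; disjoint = AllPairs.++⁺ (disjoint T₁) (disjoint T₂)
                     (All.map (λ Q⊑ → All.map (separated Q⊑) (inside T₂)) (inside T₁))
      ; covering = covering-glue
      }
      where
      separated : ∀ {Q R} → ⟦ Q ⟧ ⊑ slab B i a c → ⟦ R ⟧ ⊑ slab B i c b → InteriorsDisjoint Q R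
      separated {Q} {R} Q⊑ R⊑ = separated⇒InteriorsDisjoint i (begin
        corner Q i + side Q           ≤⟨ proj₂ (Q⊑ i) ⟩
        updateAt (hi B) i (const c) i ≡⟨ updateAt-updates i (hi B) ⟩
        c                             ≡⟨ updateAt-updates i (lo B) ⟨
        updateAt (lo B) i (const c) i ≤⟨ proj₁ (R⊑ i) ⟩
        corner R i                    ∎)
        where open ≤-Reasoning
      covering-glue : ∀ x → x ∈ᵇ slab B i a b → Any (x ∈ᶜ_) (tiles T₁ ++ tiles T₂)
      covering-glue x x∈ with ≤-total (x i) c
      ... | inj₁ x≤c = Any.++⁺ˡ (covering T₁ x (∈-slab x∈ (subst (_≤ x i) (updateAt-updates i (lo B)) (proj₁ (x∈ i))) x≤c))
      ... | inj₂ c≤x = Any.++⁺ʳ (tiles T₁) (covering T₂ x (∈-slab x∈ c≤x (subst (x i ≤_) (updateAt-updates i (hi B)) (proj₂ (x∈ i)))))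

    Tiling-stack : ∀ {S B i A s} → 0ℚ ≤ s → (∀ a → Admits S (slab B i a (a + s)) A) →
                   ∀ {k} a → Admits S (slab B i a (a + suc k · s)) (SumOf A (suc k))
    Tiling-stack {S} {B} {i} {s = s} 0≤s layer {zero} a (_∷_ {x} Ax []) =
      subst₂ (λ w n → Tiling S (slab B i a (a + w)) n) (sym (+-identityʳ s)) (sym (ℕ.+-identityʳ x)) (layer a Ax)
    Tiling-stack {S} {B} {i} {s = s} 0≤s layer {suc k} a (Ax ∷ σ) =
      Tiling-glue (p≤p+q a 0≤s) (+-monoʳ-≤ a (p≤p+q s (·-nonNeg (suc k) 0≤s))) (layer a Ax)
        (subst (λ b → Tiling S (slab B i (a + s) b) _) (+-assoc a s (suc k · s)) (Tiling-stack 0≤s layer (a + s) σ))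

    Tiling-grid : ∀ {S A s} → 0ℚ ≤ s → (∀ l → Admits S ⟦ cube l s ⟧ A) →
                  ∀ k l → Admits S ⟦ cube l (suc k · s) ⟧ (SumOf A (suc k ^ d))
    Tiling-grid {S} {A} {s} 0≤s cell k l σ =
      Tiling-cong (λ _ → refl) (λ t → cong (l t +_) (width-full t)) (partial-grid d ℕ.≤-refl l σ)
      where
      -- partial j l has corner l and sides (1+k)s along the axes t < j, s along the others;
      -- partial (1+j) l is a stack of 1+k translates of partial j along axis j.
      width : ℕ → ℕ → ℚ
      width j t = if does (t ℕ.<? j) then suc k · s else s

      partial : ℕ → Point d → Box d
      partial j l = box l (λ t → l t + width j (toℕ t))

      width-full : ∀ t → width d (toℕ t) ≡ suc k · s
      width-full t rewrite dec-true (toℕ t ℕ.<? d) (toℕ<n t) = refl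

      width-fresh : ∀ j → width j j ≡ s
      width-fresh j rewrite dec-false (j ℕ.<? j) (ℕ.<-irrefl refl) = refl

      width-stretched : ∀ j → width (suc j) j ≡ suc k · s
      width-stretched j rewrite dec-true (j ℕ.<? suc j) (ℕ.n<1+n j) = refl

      width-other : ∀ {j t} → t ≢ j → width (suc j) t ≡ width j t
      width-other {j} {t} t≢j with t ℕ.<? j
      ... | yes t<j rewrite dec-true (t ℕ.<? suc j) (ℕ.m<n⇒m<1+n t<j) | dec-true (t ℕ.<? j) t<j = refl
      ... | no  t≮j rewrite dec-false (t ℕ.<? suc j) (λ t<1+j → t≮j (ℕ.≤∧≢⇒< (ℕ.s≤s⁻¹ t<1+j) t≢j)) | dec-false (t ℕ.<? j) t≮j = refl

      partial-grid : ∀ j → j ℕ.≤ d → ∀ l → Admits S (partial j l) (SumOf A (suc k ^ j))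
      partial-grid zero    _   l (_∷_ {x} Ax []) = subst (Tiling S _) (sym (ℕ.+-identityʳ x)) (cell l Ax)
      partial-grid (suc j) j<d l σ = Tiling-cong lo≗ hi≗ (Tiling-stack 0≤s layer (l i) (SumOf-group (suc k) σ))
        where
        i = fromℕ< j<d
        i↦j : toℕ i ≡ j
        i↦j = toℕ-fromℕ< j<d
        layer : ∀ a → Admits S (slab (partial j l) i a (a + s)) (SumOf A (suc k ^ j))
        layer a σ′ = Tiling-cong (λ _ → refl)
          (updateAt-const-pointwise (λ t u v → u + width j (toℕ t) ≡ v) i (cong (a +_) (trans (cong (width j) i↦j) (width-fresh j))) (λ _ _ → refl))
          (partial-grid j (ℕ.<⇒≤ j<d) (updateAt l i (const a)) σ′)
        lo≗ : updateAt l i (const (l i)) ≗ l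
        lo≗ = updateAt-id-local i l refl
        hi≗ : updateAt (hi (partial j l)) i (const (l i + suc k · s)) ≗ hi (partial (suc j) l)
        hi≗ = updateAt-const-elim (λ t v → v ≡ l t + width (suc j) (toℕ t)) _ i
          (cong (l i +_) (sym (trans (cong (width (suc j)) i↦j) (width-stretched j))))
          (λ t t≢i → cong (l t +_) (sym (width-other (λ t↦j → t≢i (toℕ-injective (trans t↦j (sym i↦j)))))))

    Tiling⇒IsTiling : ∀ {S n} {C : Cube d} → 0ℚ < side C → (∀ {s} → S s → 0ℚ < s) → Tiling S ⟦ C ⟧ n →
                      Σ (Fin n → Cube d) λ Q → IsTiling C Q × (∀ j → S (side (Q j)))
    Tiling⇒IsTiling {S} {C = C} 0<C S⇒pos T =
      subst (λ n → Σ (Fin n → Cube d) λ Q → IsTiling C Q × (∀ j → S (side (Q j)))) (count T)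
        (Q , (0<C , (λ j → S⇒pos (side∈S j)) , disjoint′ , inside′ , covering′) , side∈S)
      where
      Q : Fin (length (tiles T)) → Cube d
      Q = lookup (tiles T)
      side∈S : ∀ j → S (side (Q j))
      side∈S j = All.lookup (sides T) (∈-lookup j)
      disjoint′ : ∀ j k → j ≢ k → InteriorsDisjoint (Q j) (Q k)
      disjoint′ j k = AllPairs-lookup (λ D (x , x∈Q , x∈R) → D (x , x∈R , x∈Q)) (disjoint T)
      inside′ : ∀ j x → x ∈ᶜ Q j → x ∈ᶜ C
      inside′ j x x∈Q = ∈-⊑ x∈Q (All.lookup (inside T) (∈-lookup j))
      covering′ : ∀ x → x ∈ᶜ C → ∃ λ j → x ∈ᶜ Q j
      covering′ x x∈C = Any.index (covering T x x∈C) , Any.lookup-index (covering T x x∈C)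

  module _ {d : ℕ} where

    AllowedSide⇒pos : ∀ {s} → AllowedSide d s → 0ℚ < s
    AllowedSide⇒pos (inj₁ refl)        = positive⁻¹ 1ℚ
    AllowedSide⇒pos (inj₂ (inj₁ refl)) = positive⁻¹ ½
    AllowedSide⇒pos (inj₂ (inj₂ refl)) = positive⁻¹ (invMersenne d) {{normalize-pos 1 (mersenne d)}}

    AllowedSide⇒≤1 : ∀ {s} → AllowedSide d s → s ≤ 1ℚ
    AllowedSide⇒≤1 (inj₁ refl)        = ≤-refl
    AllowedSide⇒≤1 (inj₂ (inj₁ refl)) = p≤[1+k]·p 1 (<⇒≤ (positive⁻¹ ½))
    AllowedSide⇒≤1 (inj₂ (inj₂ refl)) =
      subst (invMersenne d ≤_) (·-inverse (2 ^ d ∸ 2)) (p≤[1+k]·p (2 ^ d ∸ 2) (<⇒≤ (AllowedSide⇒pos (inj₂ (inj₂ refl)))))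

    unit-cube : ∀ l → Admits (AllowedSide d) ⟦ cube l 1ℚ ⟧ (Coin (2 ^ d) (mersenne d ^ d))
    unit-cube l (inj₁ refl)        = Tiling-cube (inj₁ refl)
    unit-cube l (inj₂ (inj₁ refl)) =
      Tiling-grid {d = d} (<⇒≤ (positive⁻¹ ½)) (λ l′ → λ { refl → Tiling-cube (inj₂ (inj₁ refl)) }) 1 l (SumOf-ones (2 ^ d))
    unit-cube l (inj₂ (inj₂ refl)) =
      subst (λ s → Tiling (AllowedSide d) ⟦ cube l s ⟧ (mersenne d ^ d)) (·-inverse (2 ^ d ∸ 2))
        (Tiling-grid {d = d} (<⇒≤ (AllowedSide⇒pos (inj₂ (inj₂ refl)))) (λ l′ → λ { refl → Tiling-cube (inj₂ (inj₂ refl)) })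
           (2 ^ d ∸ 2) l (SumOf-ones (mersenne d ^ d)))

    cube-tiling : ∀ {N n} → 2 ℕ.≤ N → SumOf (Coin (2 ^ d) (mersenne d ^ d)) (N ^ d) n →
      Σ (Cube d) λ C → Σ (Fin n → Cube d) λ Q →
        IsTiling C Q × (∀ j → AllowedSide d (side (Q j)) × side (Q j) < side C)
    cube-tiling {suc (suc k)} (s≤s (s≤s _)) σ =
      let Q , isTiling , allowed = Tiling⇒IsTiling (<-trans (positive⁻¹ 1ℚ) 1<N) AllowedSide⇒pos
                                     (Tiling-grid {d = d} 0≤1 unit-cube (suc k) (const 0ℚ) σ)
      in cube (const 0ℚ) (suc (suc k) · 1ℚ) , Q , isTiling ,
         λ j → allowed j , ≤-<-trans (AllowedSide⇒≤1 (allowed j)) 1<N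
      where
      0≤1 : 0ℚ ≤ 1ℚ
      0≤1 = <⇒≤ (positive⁻¹ 1ℚ)
      1<N : 1ℚ < suc (suc k) · 1ℚ
      1<N = subst (_< suc (suc k) · 1ℚ) (+-identityʳ 1ℚ)
              (+-monoʳ-< 1ℚ (<-≤-trans (positive⁻¹ 1ℚ) (p≤[1+k]·p k 0≤1)))

open Counting using (module Decomposition)
open Tilings using (cube-tiling)
open import Data.Nat using (ℕ; suc; _≤_)
open import Data.Rational using (_<_)
open import Data.Fin using (Fin)
open import Data.Product using (Σ; ∃; _×_; _,_)

mainTheorem3 : (d : ℕ) → 3 ≤ d →
    ∃ λ (n₀ : ℕ) → (n : ℕ) → n₀ ≤ n →
    Σ (Cube d) λ C → Σ (Fin n → Cube d) λ Q →
    IsTiling C Q ×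
    (∀ j → AllowedSide d (side (Q j)) × side (Q j) < side C)
-- The construction works for every d ≥ 1; 3 ≤ d only serves to exclude d = 0.
mainTheorem3 (suc d′) _ =
  let n₀ , decompose = Decomposition.decomposition d′
  in n₀ , λ n n₀≤n → let N , 2≤N , σ = decompose n₀≤n in cube-tiling 2≤N σ
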